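{- Let $r\ge 3$ and $k\ge 1$ be integers and let $G$ be a finite simple graph that is $K_{1,r}$-free. Then $\iota'_k(G)\le (r-2)(\iota_k(G)-1)+1$.
   Context: $G$ is $K_{1,r}$-free if it contains no induced subgraph isomorphic to the star $K_{1,r}$. For $S\subseteq V(G)$, $N_G[S]$ is the closed neighborhood of $S$. $K_k$ is the complete graph on $k$ vertices. A set $S\subseteq V(G)$ is $K_k$-isolating if $G-N_G[S]$ contains no subgraph isomorphic to $K_k$; $\iota_k(G)$ is the minimum cardinality of a $K_k$-isolating set. A set is independent $K_k$-isolating if it is $K_k$-isolating and induces no edge; $\iota'_k(G)$ is the minimum cardinality of an independent $K_k$-isolating set. -}

module Defs where

open import Data.Nat using (ℕ)
open import Data.Fin using (Fin)
open import Data.Fin.Subset using (Subset; _∈_; _∉_)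
open import Data.Product using (Σ; ∃; _×_)
open import Data.Sum using (_⊎_)
open import Relation.Nullary using (¬_; Dec)
open import Relation.Binary.PropositionalEquality using (_≡_; _≢_)
open import Function.Definitions using (Injective)

record Graph (n : ℕ) : Set₁ where
  field
    Adj    : Fin n → Fin n → Set
    adj?   : ∀ u v → Dec (Adj u v)
    sym    : ∀ {u v} → Adj u v → Adj v u
    irrefl : ∀ {u} → ¬ Adj u u
open Graph public

module _ {n : ℕ} (G : Graph n) where

  K1r-free : ℕ → Set
  K1r-free r = ¬ (Σ (Fin n) λ c → Σ (Fin r → Fin n) λ f →
                  Injective _≡_ _≡_ f
                  × (∀ i → Adj G c (f i))
                  × (∀ i j → ¬ Adj G (f i) (f j)))

  _∈N[_] : Fin n → Subset n → Set
  v ∈N[ S ] = Σ (Fin n) λ u → u ∈ S × (u ≡ v ⊎ Adj G u v)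

  HasKkOutside : ℕ → Subset n → Set
  HasKkOutside k S = Σ (Fin k → Fin n) λ f →
                       Injective _≡_ _≡_ f
                       × (∀ i → ¬ (f i ∈N[ S ]))
                       × (∀ i j → i ≢ j → Adj G (f i) (f j))

  IsKkIsolating : ℕ → Subset n → Set
  IsKkIsolating k S = ¬ HasKkOutside k S

  IsIndependent : Subset n → Set
  IsIndependent S = ∀ u v → u ∈ S → v ∈ S → ¬ Adj G u v

  IsMinKkIsolating : ℕ → Subset n → Set
  IsMinKkIsolating k S = IsKkIsolating k S
                         × (∀ S′ → IsKkIsolating k S′ → Data.Fin.Subset.∣ S ∣ Data.Nat.≤ Data.Fin.Subset.∣ S′ ∣)

module Submission where

open import Defs
open import Data.Nat using (ℕ; _≤_; _*_; _+_; _∸_)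
open import Data.Fin.Subset using (Subset; ∣_∣)
open import Data.Product using (Σ; _×_)

open import Data.Nat using (suc; _<_; z≤n; s≤s; _≤?_)
import Data.Nat.Properties as ℕ
open import Data.Fin using (Fin; zero; suc; _≟_; inject≤)
open import Data.Fin.Properties using (inject≤-injective)
open import Data.Fin.Subset using (_∪_; ⁅_⁆; inside; outside) renaming (⊥ to ∅; _∈_ to _∈ₛ_)
open import Data.Fin.Subset.Properties using (x∈p∪q⁻; x∈p∪q⁺; x∈⁅x⁆; x∈⁅y⁆⇒x≡y; ∉⊥; ∣⊥∣≡0; ∣⁅x⁆∣≡1)
open import Data.Vec.Base as Vec using ([]; _∷_)
open import Data.List using (List; []; _∷_; _++_; length; lookup; allFin; map)
open import Data.List.Properties using (length-++; length-map; ++-assoc)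
open import Data.List.Relation.Unary.Any using (Any; here; there; any?)
open import Data.List.Relation.Unary.Any.Properties using (++⁺ʳ)
open import Data.List.Relation.Unary.All as All using (All; []; _∷_)
open import Data.List.Relation.Unary.All.Properties using (¬Any⇒All¬; ++⁻ˡ; ++⁻ʳ)
open import Data.List.Relation.Unary.AllPairs using (AllPairs; []; _∷_)
open import Data.List.Membership.Propositional using (_∈_; find; lose)
open import Data.List.Membership.Propositional.Properties using (∈-allFin; ∈-lookup; ∈-map⁺)
open import Data.Product using (_,_; proj₁; proj₂)
open import Data.Sum using (_⊎_; inj₁; inj₂)
open import Data.Empty using (⊥-elim)
open import Function using (_∘_)
open import Function.Definitions using (Injective)
open import Relation.Nullary using (¬_; Dec; yes; no)
open import Relation.Nullary.Decidable using (_⊎-dec_)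
open import Relation.Binary.PropositionalEquality
  using (_≡_; _≢_; refl; trans; cong; subst) renaming (sym to ≡-sym)

-- Call a list of vertices scattered if its entries are distinct
-- and pairwise non-adjacent.  Given a K_k-isolating set S = {s₁, …, sₘ}, we
-- build a scattered list T with N[S] ⊆ N[T]; then T is again K_k-isolating
-- (a K_k avoiding N[T] avoids N[S]) and independent.  T is grown greedily,
-- one vertex of S at a time, starting from T = [s₁]:
--   * if s ∉ N[T], add s itself (one new vertex);
--   * if s ∈ T, nothing is needed;
--   * if s is adjacent to some t ∈ T, add a maximal scattered set A of
--     neighbours of s outside N[T].  Then {t} ∪ A is a set of pairwise
--     non-adjacent neighbours of s, so K_{1,r}-freeness gives |A| ≤ r - 2,
--     and maximality of A puts every neighbour of s into N[A ∪ T].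
-- Each step costs at most r - 2 (as r ≥ 3), giving |T| ≤ (r-2)(|S|-1) + 1.
-- The file first develops list/subset bookkeeping, then the domination
-- notions for a fixed graph, the claw bound, the greedy covering steps, and
-- finally derives the theorem.

allPairs-lookup : ∀ {A : Set} {R : A → A → Set} → (∀ {x y} → R x y → R y x) →
                  ∀ {xs} → AllPairs R xs → ∀ {i j} → i ≢ j → R (lookup xs i) (lookup xs j)
allPairs-lookup R-sym (_ ∷ _)    {zero}  {zero}  i≢j = ⊥-elim (i≢j refl)
allPairs-lookup R-sym (Rx ∷ _)   {zero}  {suc j} _   = All.lookup Rx (∈-lookup j)
allPairs-lookup R-sym (Rx ∷ _)   {suc i} {zero}  _   = R-sym (All.lookup Rx (∈-lookup i))
allPairs-lookup R-sym (_ ∷ Rxs)  {suc i} {suc j} i≢j = allPairs-lookup R-sym Rxs (i≢j ∘ cong suc)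

allPairs-++⁻ : ∀ {A : Set} {R : A → A → Set} xs {ys} → AllPairs R (xs ++ ys) →
               AllPairs R xs × AllPairs R ys × All (λ x → All (R x) ys) xs
allPairs-++⁻ []       Rys          = [] , Rys , []
allPairs-++⁻ (x ∷ xs) (Rx ∷ Rxsys) =
  let Rxs , Rys , across = allPairs-++⁻ xs Rxsys
  in ++⁻ˡ xs Rx ∷ Rxs , Rys , ++⁻ʳ xs Rx ∷ across

∣p∪q∣≤∣p∣+∣q∣ : ∀ {m} (p q : Subset m) → ∣ p ∪ q ∣ ≤ ∣ p ∣ + ∣ q ∣
∣p∪q∣≤∣p∣+∣q∣ []            []            = z≤n
∣p∪q∣≤∣p∣+∣q∣ (inside ∷ p)  (inside ∷ q)  =
  s≤s (ℕ.≤-trans (ℕ.n≤1+n _) (ℕ.≤-trans (s≤s (∣p∪q∣≤∣p∣+∣q∣ p q)) (ℕ.≤-reflexive (≡-sym (ℕ.+-suc _ _)))))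
∣p∪q∣≤∣p∣+∣q∣ (inside ∷ p)  (outside ∷ q) = s≤s (∣p∪q∣≤∣p∣+∣q∣ p q)
∣p∪q∣≤∣p∣+∣q∣ (outside ∷ p) (inside ∷ q)  =
  ℕ.≤-trans (s≤s (∣p∪q∣≤∣p∣+∣q∣ p q)) (ℕ.≤-reflexive (≡-sym (ℕ.+-suc _ _)))
∣p∪q∣≤∣p∣+∣q∣ (outside ∷ p) (outside ∷ q) = ∣p∪q∣≤∣p∣+∣q∣ p q

fromList : ∀ {m} → List (Fin m) → Subset m
fromList []       = ∅
fromList (v ∷ xs) = ⁅ v ⁆ ∪ fromList xs

∣fromList∣≤length : ∀ {m} (xs : List (Fin m)) → ∣ fromList xs ∣ ≤ length xs
∣fromList∣≤length {m} [] = ℕ.≤-reflexive (∣⊥∣≡0 m)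
∣fromList∣≤length (v ∷ xs) = ℕ.≤-trans (∣p∪q∣≤∣p∣+∣q∣ ⁅ v ⁆ (fromList xs))
  (subst (λ c → c + ∣ fromList xs ∣ ≤ suc (length xs)) (≡-sym (∣⁅x⁆∣≡1 v)) (s≤s (∣fromList∣≤length xs)))

∈fromList⁻ : ∀ {m} {u : Fin m} xs → u ∈ₛ fromList xs → u ∈ xs
∈fromList⁻ []       u∈ = ⊥-elim (∉⊥ u∈)
∈fromList⁻ (v ∷ xs) u∈ with x∈p∪q⁻ ⁅ v ⁆ (fromList xs) u∈
... | inj₁ u∈⁅v⁆ = here (x∈⁅y⁆⇒x≡y v u∈⁅v⁆)
... | inj₂ u∈xs  = there (∈fromList⁻ xs u∈xs)

∈fromList⁺ : ∀ {m} {u : Fin m} {xs} → u ∈ xs → u ∈ₛ fromList xs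
∈fromList⁺ (here refl) = x∈p∪q⁺ (inj₁ (x∈⁅x⁆ _))
∈fromList⁺ (there u∈)  = x∈p∪q⁺ (inj₂ (∈fromList⁺ u∈))

members : ∀ {m} → Subset m → List (Fin m)
members []            = []
members (inside ∷ p)  = zero ∷ map suc (members p)
members (outside ∷ p) = map suc (members p)

length-members : ∀ {m} (p : Subset m) → length (members p) ≡ ∣ p ∣
length-members []            = refl
length-members (inside ∷ p)  = cong suc (trans (length-map suc (members p)) (length-members p))
length-members (outside ∷ p) = trans (length-map suc (members p)) (length-members p)

∈members : ∀ {m} {u : Fin m} (p : Subset m) → u ∈ₛ p → u ∈ members p
∈members (inside ∷ p)  Vec.here       = here refl
∈members (inside ∷ p)  (Vec.there u∈) = there (∈-map⁺ suc (∈members p u∈))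
∈members (outside ∷ p) (Vec.there u∈) = ∈-map⁺ suc (∈members p u∈)

module Domination {n : ℕ} (G : Graph n) where

  _dominates_ : Fin n → Fin n → Set
  u dominates v = u ≡ v ⊎ Adj G u v

  Dominated : List (Fin n) → Fin n → Set
  Dominated T v = Any (_dominates v) T

  dominated? : ∀ T v → Dec (Dominated T v)
  dominated? T v = any? (λ u → (u ≟ v) ⊎-dec adj? G u v) T

  Covers : List (Fin n) → Fin n → Set
  Covers T u = ∀ {v} → u dominates v → Dominated T v

  Apart : Fin n → Fin n → Set
  Apart u v = u ≢ v × ¬ Adj G u v

  apart-sym : ∀ {u v} → Apart u v → Apart v u
  apart-sym (u≢v , ¬uv) = u≢v ∘ ≡-sym , ¬uv ∘ Graph.sym G

  Scattered : List (Fin n) → Set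
  Scattered = AllPairs Apart

  undominated-apart : ∀ {v} T → ¬ Dominated T v → All (Apart v) T
  undominated-apart T v∉N[T] = All.map apart (¬Any⇒All¬ T v∉N[T])
    where
    apart : ∀ {u v} → ¬ u dominates v → Apart v u
    apart ¬u≻v = ¬u≻v ∘ inj₁ ∘ ≡-sym , ¬u≻v ∘ inj₂ ∘ Graph.sym G

  scattered-independent : ∀ {T u v} → Scattered T → u ∈ T → v ∈ T → ¬ Adj G u v
  scattered-independent (_ ∷ _)     (here refl) (here refl) = irrefl G
  scattered-independent (apart ∷ _) (here refl) (there v∈)  = proj₂ (All.lookup apart v∈)
  scattered-independent (apart ∷ _) (there u∈)  (here refl) = proj₂ (apart-sym (All.lookup apart u∈))
  scattered-independent (_ ∷ sc)    (there u∈)  (there v∈)  = scattered-independent sc u∈ v∈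

  -- Claw bound: in a K_{1,r}-free graph, a scattered list of neighbours of a
  -- single vertex s has fewer than r entries (otherwise s and r of them
  -- would induce a K_{1,r}).
  claw-bound : ∀ {r s A} → K1r-free G r → Scattered A → All (Adj G s) A → length A < r
  claw-bound {r} {s} {A} claw-free A-sc s-adj with r ≤? length A
  ... | no r≰|A| = ℕ.≰⇒> r≰|A|
  ... | yes r≤|A| = ⊥-elim (claw-free (s , leaf , leaf-injective , leaf-adj , leaf-nonadj))
    where
    leaf : Fin r → Fin n
    leaf i = lookup A (inject≤ i r≤|A|)

    leaves-apart : ∀ {i j} → i ≢ j → Apart (leaf i) (leaf j)
    leaves-apart i≢j = allPairs-lookup apart-sym A-sc (i≢j ∘ inject≤-injective r≤|A| r≤|A| _ _)

    leaf-injective : Injective _≡_ _≡_ leaf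
    leaf-injective {i} {j} leaf-i≡leaf-j with i ≟ j
    ... | yes i≡j = i≡j
    ... | no i≢j  = ⊥-elim (proj₁ (leaves-apart i≢j) leaf-i≡leaf-j)

    leaf-adj : ∀ i → Adj G s (leaf i)
    leaf-adj i = All.lookup s-adj (∈-lookup _)

    leaf-nonadj : ∀ i j → ¬ Adj G (leaf i) (leaf j)
    leaf-nonadj i j with i ≟ j
    ... | yes refl = irrefl G
    ... | no i≢j   = proj₂ (leaves-apart i≢j)

  greedy-extension : ∀ s {T} → Scattered T → (vs : List (Fin n)) →
    Σ (List (Fin n)) λ A → Scattered (A ++ T) × All (Adj G s) A
      × (∀ {v} → v ∈ vs → Adj G s v → Dominated (A ++ T) v)
  greedy-extension s T-sc [] = [] , T-sc , [] , λ ()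
  greedy-extension s {T} T-sc (v ∷ vs) with greedy-extension s T-sc vs
  ... | A , A++T-sc , s-adj , covered with adj? G s v | dominated? (A ++ T) v
  ...   | yes sv | no v∉ = v ∷ A , undominated-apart (A ++ T) v∉ ∷ A++T-sc , sv ∷ s-adj ,
                           λ { (here refl) _ → here (inj₁ refl) ; (there w∈) sw → there (covered w∈ sw) }
  ...   | yes _  | yes v∈ = A , A++T-sc , s-adj ,
                            λ { (here refl) _ → v∈ ; (there w∈) sw → covered w∈ sw }
  ...   | no ¬sv | _      = A , A++T-sc , s-adj ,
                            λ { (here refl) sv → ⊥-elim (¬sv sv) ; (there w∈) sw → covered w∈ sw }

  module Covering {r : ℕ} (3≤r : 3 ≤ r) (claw-free : K1r-free G r) where

    cover-vertex : ∀ {T} → Scattered T → ∀ s →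
      Σ (List (Fin n)) λ A → Scattered (A ++ T) × Covers (A ++ T) s × length A ≤ r ∸ 2
    cover-vertex {T} T-sc s with dominated? T s
    ... | no s∉ = s ∷ [] , undominated-apart T s∉ ∷ T-sc , here , ℕ.∸-monoˡ-≤ 2 3≤r
    ... | yes s∈ with find s∈
    ...   | t , t∈T , inj₁ refl = [] , T-sc , lose t∈T , z≤n
    ...   | t , t∈T , inj₂ ts   = A , A++T-sc , covers , ℕ.∸-monoˡ-≤ 2 claw
      where
      extension = greedy-extension s T-sc (allFin n)
      A = proj₁ extension
      A++T-sc = proj₁ (proj₂ extension)

      -- t together with A is a scattered list of neighbours of s.
      claw : length (t ∷ A) < r
      claw = claw-bound claw-free (t-apart ∷ A-sc) (Graph.sym G ts ∷ proj₁ (proj₂ (proj₂ extension)))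
        where
        split = allPairs-++⁻ A A++T-sc
        A-sc = proj₁ split
        t-apart = All.map (λ a-apart-T → apart-sym (All.lookup a-apart-T t∈T)) (proj₂ (proj₂ split))

      covers : Covers (A ++ T) s
      covers (inj₁ refl) = ++⁺ʳ A s∈
      covers (inj₂ sv)   = proj₂ (proj₂ (proj₂ extension)) (∈-allFin _) sv

    cover-list : ∀ L {T} → Scattered T →
      Σ (List (Fin n)) λ B → Scattered (B ++ T) × All (Covers (B ++ T)) L
        × length B ≤ (r ∸ 2) * length L
    cover-list []      T-sc = [] , T-sc , [] , z≤n
    cover-list (s ∷ L) {T} T-sc with cover-vertex T-sc s
    ... | A , A++T-sc , s-cov , |A|≤ with cover-list L A++T-sc
    ...   | B , B++A++T-sc , L-cov , |B|≤ =
      B ++ A , proj₁ covered , proj₂ covered , length-bound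
      where
      covered : Scattered ((B ++ A) ++ T) × All (Covers ((B ++ A) ++ T)) (s ∷ L)
      covered = subst (λ T′ → Scattered T′ × All (Covers T′) (s ∷ L)) (≡-sym (++-assoc B A T))
                      (B++A++T-sc , (++⁺ʳ B ∘ s-cov) ∷ L-cov)

      open ℕ.≤-Reasoning
      length-bound : length (B ++ A) ≤ (r ∸ 2) * suc (length L)
      length-bound = begin
        length (B ++ A)                     ≡⟨ length-++ B ⟩
        length B + length A                 ≤⟨ ℕ.+-mono-≤ |B|≤ |A|≤ ⟩
        (r ∸ 2) * length L + (r ∸ 2)        ≡⟨ ℕ.+-comm _ (r ∸ 2) ⟩
        (r ∸ 2) + (r ∸ 2) * length L        ≡⟨ ≡-sym (ℕ.*-suc (r ∸ 2) (length L)) ⟩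
        (r ∸ 2) * suc (length L)            ∎

    cover-all : ∀ L → Σ (List (Fin n)) λ T → Scattered T × All (Covers T) L
                  × length T ≤ (r ∸ 2) * (length L ∸ 1) + 1
    cover-all []      = [] , [] , [] , z≤n
    cover-all (s ∷ L) with cover-list L {s ∷ []} ([] ∷ [])
    ... | B , B++s-sc , L-cov , |B|≤ =
      B ++ s ∷ [] , B++s-sc , (++⁺ʳ B ∘ here) ∷ L-cov ,
      ℕ.≤-trans (ℕ.≤-reflexive (length-++ B)) (ℕ.+-monoˡ-≤ 1 |B|≤)

isolating-mono : ∀ {n} (G : Graph n) {k S T} → (∀ {v} → _∈N[_] G v S → _∈N[_] G v T) →
                 IsKkIsolating G k S → IsKkIsolating G k T
isolating-mono G N[S]⊆N[T] S-isolating (f , f-injective , outside-N[T] , clique) =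
  S-isolating (f , f-injective , (λ i → outside-N[T] i ∘ N[S]⊆N[T]) , clique)

independent-dominator : ∀ {n r} (G : Graph n) → 3 ≤ r → K1r-free G r → (S : Subset n) →
  Σ (Subset n) λ T → IsIndependent G T × (∀ {v} → _∈N[_] G v S → _∈N[_] G v T)
    × ∣ T ∣ ≤ (r ∸ 2) * (∣ S ∣ ∸ 1) + 1
independent-dominator {r = r} G 3≤r claw-free S
  with Domination.Covering.cover-all G 3≤r claw-free (members S)
... | T , T-sc , S-cov , |T|≤ = fromList T , independent , N[S]⊆N[T] , size
  where
  open Domination G using (scattered-independent)

  independent : IsIndependent G (fromList T)
  independent u v u∈T v∈T = scattered-independent T-sc (∈fromList⁻ T u∈T) (∈fromList⁻ T v∈T)

  N[S]⊆N[T] : ∀ {v} → _∈N[_] G v S → _∈N[_] G v (fromList T)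
  N[S]⊆N[T] (u , u∈S , u≻v) =
    let t , t∈T , t≻v = find (All.lookup S-cov (∈members S u∈S) u≻v)
    in t , ∈fromList⁺ t∈T , t≻v

  size : ∣ fromList T ∣ ≤ (r ∸ 2) * (∣ S ∣ ∸ 1) + 1
  size = ℕ.≤-trans (∣fromList∣≤length T)
           (subst (λ m → length T ≤ (r ∸ 2) * (m ∸ 1) + 1) (length-members S) |T|≤)

theorem4 : (r k n : ℕ) → 3 ≤ r → 1 ≤ k → (G : Graph n) → K1r-free G r →
    (S : Subset n) → IsMinKkIsolating G k S →
    Σ (Subset n) λ T → IsIndependent G T × IsKkIsolating G k T
    × ∣ T ∣ ≤ (r ∸ 2) * (∣ S ∣ ∸ 1) + 1
theorem4 r k n 3≤r _ G claw-free S (S-isolating , _) =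
  let T , T-independent , N[S]⊆N[T] , |T|≤ = independent-dominator G 3≤r claw-free S
  in T , T-independent , isolating-mono G N[S]⊆N[T] S-isolating , |T|≤
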